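{- Let $p$ be an odd prime, $v$ an integral vector each of whose entries is nonzero modulo $p$, and $u$ the shortest $p$-representative of $v$. If $v$ has at least one perfect $p$-representative, then $|u^{\mathrm T}e-p|\le 3p$ and $u^{\mathrm T}u\le p^2$.
   Context: $e$ is the all-one vector. For integral vectors $v,w$: $w$ is a perfect $p$-representative of $v$ if $w\equiv v\pmod p$, $w^{\mathrm T}e=p$ and $w^{\mathrm T}w=p^2$; $w$ is the shortest $p$-representative of $v$ if $w\equiv v\pmod p$ and $|w_i|\le\frac{p-1}{2}$ for every entry $w_i$. -}

module Defs where

open import Data.Nat as ℕ using (ℕ; zero; suc)
open import Data.Nat.Primality using (Prime)
open import Data.Integer using (ℤ; +_; _+_; _-_; _*_; ∣_∣; 0ℤ)
open import Data.Integer.Divisibility using (_∣_)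
open import Data.Fin using (Fin)
open import Data.Product using (_×_)
open import Relation.Binary.PropositionalEquality using () renaming (_≡_ to _≡ᵢ_)

IVec : ℕ → Set
IVec n = Fin n → ℤ

Σe : ∀ {n} → IVec n → ℤ
Σe {zero} w = 0ℤ
Σe {suc n} w = w Fin.zero + Σe {n} (λ i → w (Fin.suc i))

dot : ∀ {n} → IVec n → IVec n → ℤ
dot {zero} w w' = 0ℤ
dot {suc n} w w' = w Fin.zero * w' Fin.zero + dot {n} (λ i → w (Fin.suc i)) (λ i → w' (Fin.suc i))

_≡_[mod_] : ∀ {n} → IVec n → IVec n → ℕ → Set
w ≡ v [mod p ] = ∀ i → (+ p) ∣ (w i - v i)

PerfectRep : ∀ {n} → ℕ → IVec n → IVec n → Set
PerfectRep p v w = (w ≡ v [mod p ]) × (Σe w ≡ᵢ + p) × (dot w w ≡ᵢ + (p ℕ.* p))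

-- u is the shortest p-representative of v : u ≡ v (mod p) and |u_i| ≤ (p-1)/2
-- (written as 2|u_i| ≤ p - 1, equivalent since entries are integers)
ShortestRep : ∀ {n} → ℕ → IVec n → IVec n → Set
ShortestRep p v u = (u ≡ v [mod p ]) × (∀ i → 2 ℕ.* ∣ u i ∣ ℕ.≤ p ℕ.∸ 1)

-- Write d_i = |u_i - w_i|, a multiple of p. A coordinate with d_i ≥ p has
-- |w_i| ≥ d_i - |u_i| > |u_i| and 2|w_i| ≥ d_i + 1 ≥ p + 1, so in every case
-- u_i² ≤ w_i² and (p + 1) d_i ≤ 4 w_i². Summing, u^T u ≤ w^T w = p² and
-- (p + 1) Σ d_i ≤ 4p²; as Σ d_i is a multiple of p this forces Σ d_i ≤ 3p,
-- which bounds |u^T e - w^T e| = |u^T e - p|.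
module Submission where

open import Defs
open import Data.Nat as ℕ using (ℕ)
open import Data.Nat.Primality using (Prime)
open import Data.Integer using (ℤ; +_; _-_; ∣_∣; _≤_)
open import Data.Integer.Divisibility using (_∣_)
open import Data.Nat.Divisibility as ℕD using ()
open import Data.Product using (_×_; ∃)
open import Relation.Nullary using (¬_)

open import Data.Nat.Base using (suc; zero; z≤n; s≤s; NonZero)
open import Data.Nat.Primality using (prime⇒nonZero)
open import Data.Nat.Properties as ℕP using (+-*-semiring)
open import Data.Nat.Tactic.RingSolver using (solve-∀)
open import Data.Integer as ℤ using (_+_; _*_; -[1+_])
open import Data.Integer.Properties as ℤP using ()
open import Data.Integer.Tactic.RingSolver as ℤSolver using ()
open import Data.Integer.Divisibility.Signed as Signed using ()
open import Data.Fin using (Fin)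
open import Data.Product using (_,_; proj₁; proj₂)
open import Data.Vec.Functional using (map)
open import Relation.Binary.PropositionalEquality
open import Algebra.Properties.Semiring.Sum +-*-semiring using (sum; *-distribˡ-sum)

far-residue-≤ : ∀ {p a b x} → p ℕ.≤ x → 2 ℕ.* a ℕ.< p → x ℕ.≤ a ℕ.+ b → suc x ℕ.≤ 2 ℕ.* b
far-residue-≤ {p} {a} {b} {x} p≤x 2a<p x≤a+b = ℕP.+-cancelʳ-< p x (2 ℕ.* b) (begin-strict
  x ℕ.+ p              ≤⟨ ℕP.+-monoʳ-≤ x p≤x ⟩
  x ℕ.+ x              ≡⟨ double x ⟩
  2 ℕ.* x              ≤⟨ ℕP.*-monoʳ-≤ 2 x≤a+b ⟩
  2 ℕ.* (a ℕ.+ b)      ≡⟨ ℕP.*-distribˡ-+ 2 a b ⟩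
  2 ℕ.* a ℕ.+ 2 ℕ.* b  <⟨ ℕP.+-monoˡ-< (2 ℕ.* b) 2a<p ⟩
  p ℕ.+ 2 ℕ.* b        ≡⟨ ℕP.+-comm p (2 ℕ.* b) ⟩
  2 ℕ.* b ℕ.+ p        ∎)
  where
  open ℕP.≤-Reasoning
  double : ∀ x → x ℕ.+ x ≡ 2 ℕ.* x
  double = solve-∀

far-residue-square : ∀ {p b x} → p ℕ.≤ x → suc x ℕ.≤ 2 ℕ.* b → suc p ℕ.* x ℕ.≤ 4 ℕ.* (b ℕ.* b)
far-residue-square {p} {b} {x} p≤x 1+x≤2b = begin
  suc p ℕ.* x              ≤⟨ ℕP.*-mono-≤ (s≤s p≤x) (ℕP.n≤1+n x) ⟩
  suc x ℕ.* suc x          ≤⟨ ℕP.*-mono-≤ 1+x≤2b 1+x≤2b ⟩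
  (2 ℕ.* b) ℕ.* (2 ℕ.* b)  ≡⟨ square-double b ⟩
  4 ℕ.* (b ℕ.* b)          ∎
  where
  open ℕP.≤-Reasoning
  square-double : ∀ b → (2 ℕ.* b) ℕ.* (2 ℕ.* b) ≡ 4 ℕ.* (b ℕ.* b)
  square-double = solve-∀

-- a, b, x play the roles of |u_i|, |w_i|, |u_i - w_i|.
residue-bounds : ∀ {p a b x} → p ℕD.∣ x → 2 ℕ.* a ℕ.< p → a ℕ.≤ b ℕ.+ x → x ℕ.≤ a ℕ.+ b
               → suc p ℕ.* x ℕ.≤ 4 ℕ.* (b ℕ.* b) × a ℕ.≤ b
residue-bounds {p} {a} {b} {zero} _ _ a≤b+0 _ =
  subst (ℕ._≤ 4 ℕ.* (b ℕ.* b)) (sym (ℕP.*-zeroʳ (suc p))) z≤n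
  , subst (a ℕ.≤_) (ℕP.+-identityʳ b) a≤b+0
residue-bounds {p} {a} {b} {x@(suc _)} p∣x 2a<p _ x≤a+b =
  far-residue-square {b = b} p≤x (far-residue-≤ {b = b} p≤x 2a<p x≤a+b) , ℕP.<⇒≤ (ℕP.+-cancelˡ-< a a b a+a<a+b)
  where
  p≤x : p ℕ.≤ x
  p≤x = ℕD.∣⇒≤ p∣x
  a+a<a+b : a ℕ.+ a ℕ.< a ℕ.+ b
  a+a<a+b = ℕP.<-≤-trans (subst (ℕ._< p) (cong (a ℕ.+_) (ℕP.+-identityʳ a)) 2a<p)
                         (ℕP.≤-trans p≤x x≤a+b)

shortest-residue-bounds : ∀ {p} (u w : ℤ) → (+ p) ∣ (u - w) → 2 ℕ.* ∣ u ∣ ℕ.< p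
                        → suc p ℕ.* ∣ u - w ∣ ℕ.≤ 4 ℕ.* (∣ w ∣ ℕ.* ∣ w ∣) × ∣ u ∣ ℕ.≤ ∣ w ∣
shortest-residue-bounds u w p∣u-w 2∣u∣<p =
  residue-bounds p∣u-w 2∣u∣<p ∣u∣≤∣w∣+∣u-w∣ (ℤP.∣i-j∣≤∣i∣+∣j∣ u w)
  where
  u≡w+[u-w] : ∀ u w → u ≡ w + (u - w)
  u≡w+[u-w] = ℤSolver.solve-∀
  ∣u∣≤∣w∣+∣u-w∣ : ∣ u ∣ ℕ.≤ ∣ w ∣ ℕ.+ ∣ u - w ∣
  ∣u∣≤∣w∣+∣u-w∣ = subst (λ z → ∣ z ∣ ℕ.≤ ∣ w ∣ ℕ.+ ∣ u - w ∣) (sym (u≡w+[u-w] u w))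
                        (ℤP.∣i+j∣≤∣i∣+∣j∣ w (u - w))

∣-congruent : ∀ {p} u v w → (+ p) ∣ (u - v) → (+ p) ∣ (w - v) → (+ p) ∣ (u - w)
∣-congruent {p} u v w p∣u-v p∣w-v = Signed.∣⇒∣ᵤ (subst (Signed._∣_ (+ p)) (sym (difference u v w))
  (Signed.∣m∣n⇒∣m-n (Signed.∣ᵤ⇒∣ {i = u - v} p∣u-v) (Signed.∣ᵤ⇒∣ {i = w - v} p∣w-v)))
  where
  difference : ∀ u v w → u - w ≡ (u - v) - (w - v)
  difference = ℤSolver.solve-∀

multiple-≤-3*-of-bound : ∀ {p d} .{{_ : NonZero p}} → p ℕD.∣ d → suc p ℕ.* d ℕ.≤ 4 ℕ.* (p ℕ.* p) → d ℕ.≤ 3 ℕ.* p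
multiple-≤-3*-of-bound {p} (ℕD.divides c refl) bound = ℕP.*-monoˡ-≤ p (ℕP.<⇒≤pred c<4)
  where
  reassoc : ∀ p c → suc p ℕ.* (c ℕ.* p) ≡ (c ℕ.* suc p) ℕ.* p
  reassoc = solve-∀
  square-reassoc : ∀ p → 4 ℕ.* (p ℕ.* p) ≡ (4 ℕ.* p) ℕ.* p
  square-reassoc = solve-∀
  c*[1+p]≤4p : c ℕ.* suc p ℕ.≤ 4 ℕ.* p
  c*[1+p]≤4p = ℕP.*-cancelʳ-≤ (c ℕ.* suc p) (4 ℕ.* p) p
    (subst₂ ℕ._≤_ (reassoc p c) (square-reassoc p) bound)
  c<4 : c ℕ.< 4
  c<4 = ℕP.*-cancelʳ-< (suc p) c 4 (ℕP.≤-<-trans c*[1+p]≤4p (ℕP.*-monoʳ-< 4 (ℕP.n<1+n p)))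

sum-mono-≤ : ∀ {n} {f g : Fin n → ℕ} → (∀ i → f i ℕ.≤ g i) → sum f ℕ.≤ sum g
sum-mono-≤ {zero} _ = z≤n
sum-mono-≤ {suc n} f≤g = ℕP.+-mono-≤ (f≤g Fin.zero) (sum-mono-≤ (λ i → f≤g (Fin.suc i)))

∣-sum : ∀ {n p} {f : Fin n → ℕ} → (∀ i → p ℕD.∣ f i) → p ℕD.∣ sum f
∣-sum {zero} {p} _ = p ℕD.∣0
∣-sum {suc n} p∣f = ℕD.∣m∣n⇒∣m+n (p∣f Fin.zero) (∣-sum (λ i → p∣f (Fin.suc i)))

∣Σe-Σe∣≤sum∣-∣ : ∀ {n} (u w : IVec n) → ∣ Σe u - Σe w ∣ ℕ.≤ sum (λ i → ∣ u i - w i ∣)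
∣Σe-Σe∣≤sum∣-∣ {zero} u w = z≤n
∣Σe-Σe∣≤sum∣-∣ {suc n} u w = begin
  ∣ Σe u - Σe w ∣                       ≡⟨ cong ∣_∣ (interchange (u Fin.zero) (Σe u′) (w Fin.zero) (Σe w′)) ⟩
  ∣ (u Fin.zero - w Fin.zero) + (Σe u′ - Σe w′) ∣
    ≤⟨ ℤP.∣i+j∣≤∣i∣+∣j∣ (u Fin.zero - w Fin.zero) (Σe u′ - Σe w′) ⟩
  ∣ u Fin.zero - w Fin.zero ∣ ℕ.+ ∣ Σe u′ - Σe w′ ∣
    ≤⟨ ℕP.+-monoʳ-≤ ∣ u Fin.zero - w Fin.zero ∣ (∣Σe-Σe∣≤sum∣-∣ u′ w′) ⟩
  sum (λ i → ∣ u i - w i ∣)          ∎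
  where
  open ℕP.≤-Reasoning
  u′ w′ : IVec n
  u′ i = u (Fin.suc i)
  w′ i = w (Fin.suc i)
  interchange : ∀ a b c d → (a + b) - (c + d) ≡ (a - c) + (b - d)
  interchange = ℤSolver.solve-∀

i*i≡+∣i∣*∣i∣ : ∀ i → i * i ≡ + (∣ i ∣ ℕ.* ∣ i ∣)
i*i≡+∣i∣*∣i∣ (+ n)    = ℤP.+◃n≡+n (n ℕ.* n)
i*i≡+∣i∣*∣i∣ -[1+ n ] = ℤP.+◃n≡+n (suc n ℕ.* suc n)

dot-self : ∀ {n} (w : IVec n) → dot w w ≡ + (sum (λ i → ∣ w i ∣ ℕ.* ∣ w i ∣))
dot-self {zero} w = refl
dot-self {suc n} w = cong₂ _+_ (i*i≡+∣i∣*∣i∣ (w Fin.zero)) (dot-self (λ i → w (Fin.suc i)))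

proposition3p9 : (p : ℕ) → Prime p → ¬ (2 ℕD.∣ p) → (n : ℕ) → (v u : IVec n)
    → (∀ i → ¬ ((+ p) ∣ v i)) → ShortestRep p v u → ∃ (λ w → PerfectRep p v w)
    → (∣ Σe u - + p ∣ ℕ.≤ 3 ℕ.* p) × (dot u u ≤ + (p ℕ.* p))
proposition3p9 p p-prime _ n v u _ (u≡v , u-short) (w , w≡v , Σw≡p , ww≡p²) =
  Σ-bound , dot-bound
  where
  instance _ = prime⇒nonZero p-prime
  d w² : Fin n → ℕ
  d i = ∣ u i - w i ∣
  w² i = ∣ w i ∣ ℕ.* ∣ w i ∣
  p∣d : ∀ i → (+ p) ∣ (u i - w i)
  p∣d i = ∣-congruent (u i) (v i) (w i) (u≡v i) (w≡v i)
  bounds : ∀ i → suc p ℕ.* d i ℕ.≤ 4 ℕ.* w² i × ∣ u i ∣ ℕ.≤ ∣ w i ∣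
  bounds i = shortest-residue-bounds (u i) (w i) (p∣d i)
                                     (ℕP.m≤pred[n]⇒suc[m]≤n (u-short i))
  sum-w²≡p² : sum w² ≡ p ℕ.* p
  sum-w²≡p² = ℤP.+-injective (trans (sym (dot-self w)) ww≡p²)
  dot-bound : dot u u ≤ + (p ℕ.* p)
  dot-bound = subst₂ _≤_ (sym (dot-self u)) (cong +_ sum-w²≡p²)
    (ℤ.+≤+ (sum-mono-≤ (λ i → ℕP.*-mono-≤ (proj₂ (bounds i)) (proj₂ (bounds i)))))
  sum-d≤3p : sum d ℕ.≤ 3 ℕ.* p
  sum-d≤3p = multiple-≤-3*-of-bound (∣-sum p∣d) (begin
    suc p ℕ.* sum d                ≡⟨ *-distribˡ-sum (suc p) d ⟩
    sum (map (suc p ℕ.*_) d)       ≤⟨ sum-mono-≤ (λ i → proj₁ (bounds i)) ⟩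
    sum (map (4 ℕ.*_) w²)          ≡⟨ *-distribˡ-sum 4 w² ⟨
    4 ℕ.* sum w²                   ≡⟨ cong (4 ℕ.*_) sum-w²≡p² ⟩
    4 ℕ.* (p ℕ.* p)                ∎)
    where open ℕP.≤-Reasoning
  Σ-bound : ∣ Σe u - + p ∣ ℕ.≤ 3 ℕ.* p
  Σ-bound = subst (λ s → ∣ Σe u - s ∣ ℕ.≤ 3 ℕ.* p) Σw≡p
    (ℕP.≤-trans (∣Σe-Σe∣≤sum∣-∣ u w) sum-d≤3p)
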